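{- Let $G$ be a finite abelian group of order $n\ge 2$ and let $t\ge 2$ be an integer. Then $$s(G,t) < \left( \frac{1}{2} \left\lfloor \frac{t}{2} \right\rfloor !\, n \right)^{1/\lfloor t/2 \rfloor}.$$
   Context: $G$ is written additively. For a non-negative integer $t$, a subset $A=\{a_1,\dots,a_m\}$ of $G$ (with $m\ge1$) is called $t$-independent if whenever $\lambda_1a_1+\cdots+\lambda_ma_m=0$ for integers $\lambda_1,\dots,\lambda_m$ with $|\lambda_1|+\cdots+|\lambda_m|\le t$, we have $\lambda_1=\cdots=\lambda_m=0$. $s(G,t)$ denotes the largest size of a $t$-independent subset of $G$, with $s(G,t)=0$ if $G$ has no $t$-independent subset. -}

module Defs where

open import Data.Nat using (ℕ; zero; suc; _+_; _≤_; _<_; _*_; _^_; _!; ⌊_/2⌋)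
open import Data.Integer using (ℤ; +_; -[1+_]; ∣_∣)
open import Data.Fin using (Fin) renaming (zero to fz; suc to fs)
open import Function.Bundles using (Inverse)
open import Algebra.Bundles using (AbelianGroup)
import Algebra.Definitions.RawMonoid as RM
import Relation.Binary.PropositionalEquality as ≡
open ≡ using (_≡_)

HasOrder : ∀ {c ℓ} → AbelianGroup c ℓ → ℕ → Set _
HasOrder G n = Inverse (AbelianGroup.setoid G) (≡.setoid (Fin n))

norm : ∀ {m} → (Fin m → ℤ) → ℕ
norm {zero} λs = 0
norm {suc m} λs = ∣ λs fz ∣ + norm (λ i → λs (fs i))

module _ {c ℓ} (G : AbelianGroup c ℓ) where
  open AbelianGroup G
  open RM rawMonoid using (sum) renaming (_×_ to _·ℕ_)

  -- integer multiple λ · x  (additive notation: ∙ is the group law, ⁻¹ the negation)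
  _·ℤ_ : ℤ → Carrier → Carrier
  (+ k) ·ℤ x = k ·ℕ x
  -[1+ k ] ·ℤ x = (suc k ·ℕ x) ⁻¹

  lincomb : ∀ {m} → (Fin m → ℤ) → (Fin m → Carrier) → Carrier
  lincomb λs a = sum (λ i → λs i ·ℤ a i)

  -- a = (a₁,…,aₘ) lists m pairwise distinct elements, i.e. the set {a₁,…,aₘ} has size m
  Distinct : ∀ {m} → (Fin m → Carrier) → Set _
  Distinct a = ∀ i j → a i ≈ a j → i ≡ j

  TIndependent : ℕ → ∀ {m} → (Fin m → Carrier) → Set _
  TIndependent t {m} a =
    (λs : Fin m → ℤ) → norm λs ≤ t → lincomb λs a ≈ ε → ∀ i → λs i ≡ + 0

-- Put k = ⌊t/2⌋ and let S be the set of non-negative integer vectors of length m and ℓ¹ norm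
-- exactly k, the weak compositions of k into m parts. The 1 + 2|S| vectors 0, ±v (v ∈ S) are
-- pairwise distinct, and the difference of any two of them has norm at most 2k ≤ t. By
-- t-independence their linear combinations of a₁,…,aₘ are therefore pairwise distinct elements
-- of G, so 1 + 2|S| ≤ n. Finally |S| = m(m+1)⋯(m+k-1)/k! ≥ mᵏ/k!.
module Submission where

open import Defs
open import Data.Nat as ℕ
  using (ℕ; zero; suc; _≤_; _<_; _*_; _+_; _^_; _!; ⌊_/2⌋; z≤n; s≤s)
import Data.Nat.Properties as ℕP
open import Data.Nat.Tactic.RingSolver using (solve-∀)
open import Data.Integer as ℤ using (ℤ; +_; -[1+_]; ∣_∣; _⊖_)
import Data.Integer.Properties as ℤP
open import Data.Fin using (Fin) renaming (zero to fz; suc to fs)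
import Data.Fin.Properties as FinP
open import Data.List using (List; []; _∷_; _++_; map; length; lookup)
open import Data.List.Properties using (length-++; length-map)
open import Data.List.Relation.Unary.All as All using (All; []; _∷_)
import Data.List.Relation.Unary.All.Properties as AllP
open import Data.List.Relation.Unary.AllPairs as AllPairs using (AllPairs; []; _∷_)
import Data.List.Relation.Unary.AllPairs.Properties as AllPairsP
open import Data.List.Membership.Propositional using (_∈_)
open import Data.List.Membership.Propositional.Properties using (∈-lookup; ∈-map⁻)
open import Data.Product using (_,_)
open import Data.Empty using (⊥-elim)
open import Data.Vec.Functional as Vector using (Vector; updateAt)
open import Function using (_∘_; _on_; Inverse)
open import Relation.Nullary using (¬_)
open import Relation.Nullary.Decidable using (decidable-stable)
open import Relation.Binary.Definitions using (Symmetric)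
open import Function.Bundles using (Injection)
open import Function.Properties.Inverse using (Inverse⇒Injection)
open import Relation.Binary.PropositionalEquality as ≡
  using (_≡_; _≢_; _≗_; refl; sym; trans; cong; cong₂)
open import Algebra.Bundles using (AbelianGroup)
import Algebra.Definitions.RawMonoid as RawMonoidDefs
import Algebra.Properties.Monoid.Mult as MonoidMult
import Algebra.Properties.Monoid.Sum as MonoidSum
import Algebra.Properties.CommutativeMonoid.Sum as CommutativeMonoidSum
import Algebra.Properties.CommutativeSemigroup as CommutativeSemigroupProperties
import Algebra.Properties.Group as GroupProperties
import Algebra.Properties.AbelianGroup as AbelianGroupProperties
import Relation.Binary.Reasoning.Setoid as SetoidReasoning

_≉_ : ∀ {A : Set} {m} → (Fin m → A) → (Fin m → A) → Set
u ≉ w = ¬ (u ≗ w)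

AllPairs-lookup : ∀ {A : Set} {R : A → A → Set} → Symmetric R →
                  ∀ {xs} → AllPairs R xs → ∀ {p q} → p ≢ q → R (lookup xs p) (lookup xs q)
AllPairs-lookup R-sym (_ ∷ _)    {fz}   {fz}   p≢q = ⊥-elim (p≢q refl)
AllPairs-lookup R-sym (Rx ∷ _)   {fz}   {fs q} _   = All.lookup Rx (∈-lookup q)
AllPairs-lookup R-sym (Rx ∷ _)   {fs p} {fz}   _   = R-sym (All.lookup Rx (∈-lookup p))
AllPairs-lookup R-sym (_ ∷ Rxs) {fs p} {fs q} p≢q = AllPairs-lookup R-sym Rxs (p≢q ∘ cong fs)

AllPairs-≢-length≤ : ∀ {A : Set} {n} (f : A → Fin n) {xs} →
                     AllPairs (_≢_ on f) xs → length xs ≤ n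
AllPairs-≢-length≤ f {xs} distinct = FinP.injective⇒≤ {f = f ∘ lookup xs} λ {p} {q} fp≡fq →
  decidable-stable (p FinP.≟ q) λ p≢q → AllPairs-lookup (_∘ sym) distinct p≢q fp≡fq

AllPairs-mapWith-All : ∀ {A : Set} {P : A → Set} {R S : A → A → Set} →
                       (∀ {x y} → P x → P y → R x y → S x y) →
                       ∀ {xs} → All P xs → AllPairs R xs → AllPairs S xs
AllPairs-mapWith-All f []         []         = []
AllPairs-mapWith-All f (px ∷ pxs) (Rx ∷ Rxs) =
  All.zipWith (λ (py , Rxy) → f px py Rxy) (pxs , Rx) ∷ AllPairs-mapWith-All f pxs Rxs

⌊n/2⌋+⌊n/2⌋≤n : ∀ n → ⌊ n /2⌋ + ⌊ n /2⌋ ≤ n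
⌊n/2⌋+⌊n/2⌋≤n n =
  ℕP.≤-trans (ℕP.+-monoʳ-≤ ⌊ n /2⌋ (ℕP.⌊n/2⌋≤⌈n/2⌉ n))
             (ℕP.≤-reflexive (ℕP.⌊n/2⌋+⌈n/2⌉≡n n))

norm-cong : ∀ {m} {u w : Fin m → ℤ} → u ≗ w → norm u ≡ norm w
norm-cong {zero}  u≗w = refl
norm-cong {suc m} u≗w = cong₂ _+_ (cong ∣_∣ (u≗w fz)) (norm-cong (u≗w ∘ fs))

norm-− : ∀ {m} (u w : Fin m → ℤ) → norm (λ i → u i ℤ.- w i) ≤ norm u + norm w
norm-− {zero}  u w = z≤n
norm-− {suc m} u w = ℕP.≤-trans
  (ℕP.+-mono-≤ (ℤP.∣i-j∣≤∣i∣+∣j∣ (u fz) (w fz)) (norm-− (u ∘ fs) (w ∘ fs)))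
  (ℕP.≤-reflexive (CommutativeSemigroupProperties.interchange ℕP.+-commutativeSemigroup
    ∣ u fz ∣ ∣ w fz ∣ (norm (u ∘ fs)) (norm (w ∘ fs))))

norm-0 : ∀ m → norm {m} (λ _ → + 0) ≡ 0
norm-0 zero    = refl
norm-0 (suc m) = norm-0 m

norm-neg : ∀ {m} (u : Fin m → ℤ) → norm (λ i → ℤ.- u i) ≡ norm u
norm-neg {zero}  u = refl
norm-neg {suc m} u = cong₂ _+_ (ℤP.∣-i∣≡∣i∣ (u fz)) (norm-neg (u ∘ fs))

module LinearCombinations {c ℓ} (G : AbelianGroup c ℓ) where
  open AbelianGroup G renaming (sym to ≈-sym; trans to ≈-trans)
  open RawMonoidDefs rawMonoid using () renaming (_×_ to _·ℕ_)
  open MonoidMult monoid using (×-homo-+)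
  open MonoidSum monoid using (sum; sum-cong-≋)
  open CommutativeMonoidSum commutativeMonoid using (∑-distrib-+)
  open CommutativeSemigroupProperties commutativeSemigroup using (interchange)
  open GroupProperties group using (ε⁻¹≈ε; ⁻¹-involutive; x≈y⇒x∙y⁻¹≈ε)
  open AbelianGroupProperties G using (⁻¹-∙-comm)
  open SetoidReasoning setoid

  private
    _·_ : ℤ → Carrier → Carrier
    _·_ = _·ℤ_ G

  x-ε≈x : ∀ x → x - ε ≈ x
  x-ε≈x x = ≈-trans (∙-congˡ ε⁻¹≈ε) (identityʳ x)

  ∙-−-cancelˡ : ∀ x u v → (x ∙ u) - (x ∙ v) ≈ u - v
  ∙-−-cancelˡ x u v = begin
    (x ∙ u) ∙ (x ∙ v) ⁻¹     ≈⟨ ∙-congˡ (⁻¹-∙-comm x v) ⟨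
    (x ∙ u) ∙ (x ⁻¹ ∙ v ⁻¹)  ≈⟨ interchange x u (x ⁻¹) (v ⁻¹) ⟩
    (x ∙ x ⁻¹) ∙ (u ∙ v ⁻¹)  ≈⟨ ∙-congʳ (inverseʳ x) ⟩
    ε ∙ (u ∙ v ⁻¹)           ≈⟨ identityˡ _ ⟩
    u ∙ v ⁻¹                 ∎

  ·-homo-⊖ : ∀ a b x → (a ⊖ b) · x ≈ a ·ℕ x - b ·ℕ x
  ·-homo-⊖ a zero x rewrite ℤP.⊖-≥ {a} {0} z≤n = ≈-sym (x-ε≈x (a ·ℕ x))
  ·-homo-⊖ zero (suc b) x rewrite ℤP.⊖-< {0} {suc b} (s≤s z≤n) = ≈-sym (identityˡ _)
  ·-homo-⊖ (suc a) (suc b) x rewrite ℤP.[1+m]⊖[1+n]≡m⊖n a b =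
    ≈-trans (·-homo-⊖ a b x) (≈-sym (∙-−-cancelˡ x _ _))

  ·-homo-− : ∀ p q x → (p ℤ.- q) · x ≈ p · x - q · x
  ·-homo-− p (+ zero) x rewrite ℤP.+-identityʳ p = ≈-sym (x-ε≈x (p · x))
  ·-homo-− (+ a) (+ suc b) x = ·-homo-⊖ a (suc b) x
  ·-homo-− -[1+ a ] (+ suc b) x = begin
    (suc (suc (a + b)) ·ℕ x) ⁻¹             ≡⟨ cong (λ j → (j ·ℕ x) ⁻¹) (ℕP.+-suc (suc a) b) ⟨
    ((suc a + suc b) ·ℕ x) ⁻¹               ≈⟨ ⁻¹-cong (×-homo-+ x (suc a) (suc b)) ⟩
    (suc a ·ℕ x ∙ suc b ·ℕ x) ⁻¹            ≈⟨ ⁻¹-∙-comm _ _ ⟨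
    (suc a ·ℕ x) ⁻¹ ∙ (suc b ·ℕ x) ⁻¹       ∎
  ·-homo-− (+ a) -[1+ b ] x = begin
    (a + suc b) ·ℕ x                        ≈⟨ ×-homo-+ x a (suc b) ⟩
    a ·ℕ x ∙ suc b ·ℕ x                     ≈⟨ ∙-congˡ (⁻¹-involutive _) ⟨
    a ·ℕ x ∙ ((suc b ·ℕ x) ⁻¹) ⁻¹           ∎
  ·-homo-− -[1+ a ] -[1+ b ] x = begin
    (suc b ⊖ suc a) · x                     ≈⟨ ·-homo-⊖ (suc b) (suc a) x ⟩
    suc b ·ℕ x ∙ (suc a ·ℕ x) ⁻¹            ≈⟨ comm _ _ ⟩
    (suc a ·ℕ x) ⁻¹ ∙ suc b ·ℕ x            ≈⟨ ∙-congˡ (⁻¹-involutive _) ⟨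
    (suc a ·ℕ x) ⁻¹ ∙ ((suc b ·ℕ x) ⁻¹) ⁻¹  ∎

  ∑-distrib-⁻¹ : ∀ {m} (f : Fin m → Carrier) → sum (λ i → f i ⁻¹) ≈ sum f ⁻¹
  ∑-distrib-⁻¹ {zero}  f = ≈-sym ε⁻¹≈ε
  ∑-distrib-⁻¹ {suc m} f = ≈-trans (∙-congˡ (∑-distrib-⁻¹ (f ∘ fs))) (⁻¹-∙-comm (f fz) _)

  lincomb-homo-− : ∀ {m} (λs μs : Fin m → ℤ) (a : Fin m → Carrier) →
              lincomb G (λ i → λs i ℤ.- μs i) a ≈ lincomb G λs a - lincomb G μs a
  lincomb-homo-− λs μs a = begin
    sum (λ i → (λs i ℤ.- μs i) · a i)
      ≈⟨ sum-cong-≋ (λ i → ·-homo-− (λs i) (μs i) (a i)) ⟩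
    sum (λ i → λs i · a i - μs i · a i)
      ≈⟨ ∑-distrib-+ (λ i → λs i · a i) (λ i → (μs i · a i) ⁻¹) ⟩
    lincomb G λs a ∙ sum (λ i → (μs i · a i) ⁻¹)
      ≈⟨ ∙-congˡ (∑-distrib-⁻¹ (λ i → μs i · a i)) ⟩
    lincomb G λs a - lincomb G μs a
      ∎

  independent⇒lincomb-injective :
    ∀ {t m} {a : Fin m → Carrier} → TIndependent G t a →
    ∀ (u w : Fin m → ℤ) → norm u + norm w ≤ t → lincomb G u a ≈ lincomb G w a → u ≗ w
  independent⇒lincomb-injective ind u w ∣u∣+∣w∣≤t u≈w i = ℤP.i-j≡0⇒i≡j (u i) (w i)
    (ind (λ j → u j ℤ.- w j) (ℕP.≤-trans (norm-− u w) ∣u∣+∣w∣≤t)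
         (≈-trans (lincomb-homo-− u w _) (x≈y⇒x∙y⁻¹≈ε u≈w)) i)

open LinearCombinations using (independent⇒lincomb-injective)

independent⇒length≤order :
  ∀ {c ℓ} (G : AbelianGroup c ℓ) {n t m k} {a : Fin m → AbelianGroup.Carrier G} →
  HasOrder G n → TIndependent G t a → k + k ≤ t →
  ∀ {us : List (Fin m → ℤ)} → All (λ u → norm u ≤ k) us → AllPairs _≉_ us → length us ≤ n
independent⇒length≤order G {n} {t} {m} {k} {a} G≅Fin independent k+k≤t us≤k us-unique =
  AllPairs-≢-length≤ toFin (AllPairs-mapWith-All images-differ us≤k us-unique)
  where
  toFin : (Fin m → ℤ) → Fin n
  toFin u = Inverse.to G≅Fin (lincomb G u a)
  images-differ : ∀ {u w} → norm u ≤ k → norm w ≤ k → u ≉ w → toFin u ≢ toFin w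
  images-differ ∣u∣≤k ∣w∣≤k u≉w toFin-u≡w = u≉w (independent⇒lincomb-injective G independent _ _
    (ℕP.≤-trans (ℕP.+-mono-≤ ∣u∣≤k ∣w∣≤k) k+k≤t)
    (Injection.injective (Inverse⇒Injection G≅Fin) toFin-u≡w))

weakCompositions : (m k : ℕ) → List (Vector ℕ m)
weakCompositions zero    zero    = (λ ()) ∷ []
weakCompositions zero    (suc k) = []
weakCompositions (suc m) zero    = (λ _ → 0) ∷ []
weakCompositions (suc m) (suc k) =
  map (λ v → updateAt v fz suc) (weakCompositions (suc m) k) ++
  map (0 Vector.∷_) (weakCompositions m (suc k))

weakCompositions-norm : ∀ m k → All (λ v → norm (+_ ∘ v) ≡ k) (weakCompositions m k)
weakCompositions-norm zero    zero    = refl ∷ []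
weakCompositions-norm zero    (suc k) = []
weakCompositions-norm (suc m) zero    = norm-0 (suc m) ∷ []
weakCompositions-norm (suc m) (suc k) = AllP.++⁺
  (AllP.map⁺ (All.map (cong suc) (weakCompositions-norm (suc m) k)))
  (AllP.map⁺ (weakCompositions-norm m (suc k)))

weakCompositions-unique : ∀ m k → AllPairs _≉_ (weakCompositions m k)
weakCompositions-unique zero    zero    = [] ∷ []
weakCompositions-unique zero    (suc k) = []
weakCompositions-unique (suc m) zero    = [] ∷ []
weakCompositions-unique (suc m) (suc k) = AllPairsP.++⁺
  (AllPairsP.map⁺ (AllPairs.map
    (λ v≉w v′≗w′ → v≉w λ { fz → ℕP.suc-injective (v′≗w′ fz) ; (fs i) → v′≗w′ (fs i) })
    (weakCompositions-unique (suc m) k)))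
  (AllPairsP.map⁺ (AllPairs.map (λ v≉w v′≗w′ → v≉w (v′≗w′ ∘ fs)) (weakCompositions-unique m (suc k))))
  (All.tabulate λ v∈ → All.tabulate λ w∈ → heads-differ v∈ w∈)
  where
  heads-differ : ∀ {v w} → v ∈ map (λ v → updateAt v fz suc) (weakCompositions (suc m) k) →
                 w ∈ map (0 Vector.∷_) (weakCompositions m (suc k)) → v ≉ w
  heads-differ v∈ w∈ v≗w with ∈-map⁻ _ v∈ | ∈-map⁻ _ w∈
  ... | _ , _ , refl | _ , _ , refl with v≗w fz
  ... | ()

length-weakCompositions : ∀ m k → length (weakCompositions (suc m) (suc k)) ≡
                          length (weakCompositions (suc m) k) + length (weakCompositions m (suc k))
length-weakCompositions m k = trans (length-++ (map _ (weakCompositions (suc m) k)))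
  (cong₂ _+_ (length-map _ (weakCompositions (suc m) k))
             (length-map _ (weakCompositions m (suc k))))

risingFactorial : ℕ → ℕ → ℕ
risingFactorial m zero    = 1
risingFactorial m (suc k) = m * risingFactorial (suc m) k

^≤risingFactorial : ∀ m k → m ^ k ≤ risingFactorial m k
^≤risingFactorial m zero    = ℕP.≤-refl
^≤risingFactorial m (suc k) =
  ℕP.*-monoʳ-≤ m (ℕP.≤-trans (ℕP.^-monoˡ-≤ k (ℕP.n≤1+n m)) (^≤risingFactorial (suc m) k))

risingFactorial-suc : ∀ m k → risingFactorial m (suc k) ≡ risingFactorial m k * (m + k)
risingFactorial-suc m zero    = base m
  where
  base : ∀ m → m * 1 ≡ 1 * (m + 0)
  base = solve-∀
risingFactorial-suc m (suc k) =
  trans (cong (m *_) (risingFactorial-suc (suc m) k)) (regroup m k (risingFactorial (suc m) k))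
  where
  regroup : ∀ m k r → m * (r * (suc m + k)) ≡ m * r * (m + suc k)
  regroup = solve-∀

risingFactorial≤!*length-weakCompositions : ∀ m k →
  risingFactorial m k ≤ k ! * length (weakCompositions m k)
risingFactorial≤!*length-weakCompositions zero    zero    = ℕP.≤-refl
risingFactorial≤!*length-weakCompositions zero    (suc k) = z≤n
risingFactorial≤!*length-weakCompositions (suc m) zero    = ℕP.≤-refl
risingFactorial≤!*length-weakCompositions (suc m) (suc k) = begin
  risingFactorial (suc m) (suc k)
    ≡⟨ risingFactorial-suc (suc m) k ⟩
  risingFactorial (suc m) k * (suc m + k)
    ≡⟨ pascal (risingFactorial (suc m) k) m k ⟩
  suc k * risingFactorial (suc m) k + risingFactorial m (suc k)
    ≤⟨ ℕP.+-mono-≤ (ℕP.*-monoʳ-≤ (suc k) (risingFactorial≤!*length-weakCompositions (suc m) k))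
                   (risingFactorial≤!*length-weakCompositions m (suc k)) ⟩
  suc k * (k ! * L₁) + suc k ! * L₂
    ≡⟨ regroup (suc k) (k !) L₁ L₂ ⟩
  suc k ! * (L₁ + L₂)
    ≡⟨ cong (suc k ! *_) (length-weakCompositions m k) ⟨
  suc k ! * length (weakCompositions (suc m) (suc k))
    ∎
  where
  open ℕP.≤-Reasoning
  L₁ L₂ : ℕ
  L₁ = length (weakCompositions (suc m) k)
  L₂ = length (weakCompositions m (suc k))
  pascal : ∀ r m k → r * (suc m + k) ≡ suc k * r + m * r
  pascal = solve-∀
  regroup : ∀ x y u v → x * (y * u) + x * y * v ≡ x * y * (u + v)
  regroup = solve-∀

^≤!*length-weakCompositions : ∀ m k → m ^ k ≤ k ! * length (weakCompositions m k)
^≤!*length-weakCompositions m k =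
  ℕP.≤-trans (^≤risingFactorial m k) (risingFactorial≤!*length-weakCompositions m k)

signedWeakCompositions : (m k : ℕ) → List (Fin m → ℤ)
signedWeakCompositions m k =
  (λ _ → + 0) ∷ map (λ v i → + v i) (weakCompositions m k) ++
                map (λ v i → ℤ.- (+ v i)) (weakCompositions m k)

length-signedWeakCompositions : ∀ m k → length (signedWeakCompositions m k) ≡
                                suc (length (weakCompositions m k) + length (weakCompositions m k))
length-signedWeakCompositions m k = cong suc (trans (length-++ (map _ (weakCompositions m k)))
  (cong₂ _+_ (length-map _ (weakCompositions m k)) (length-map _ (weakCompositions m k))))

signedWeakCompositions-norm : ∀ m k → All (λ u → norm u ≤ k) (signedWeakCompositions m k)
signedWeakCompositions-norm m k = ℕP.≤-trans (ℕP.≤-reflexive (norm-0 m)) z≤n ∷ AllP.++⁺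
  (AllP.map⁺ (All.map ℕP.≤-reflexive (weakCompositions-norm m k)))
  (AllP.map⁺ (All.map (λ {v} ∣v∣≡k → ℕP.≤-reflexive (trans (norm-neg (+_ ∘ v)) ∣v∣≡k))
                      (weakCompositions-norm m k)))

signedWeakCompositions-unique : ∀ m k → AllPairs _≉_ (signedWeakCompositions m (suc k))
signedWeakCompositions-unique m k = zero≉ ∷ AllPairsP.++⁺
  (AllPairsP.map⁺ (AllPairs.map (λ v≉w v≗w → v≉w (ℤP.+-injective ∘ v≗w))
                                (weakCompositions-unique m (suc k))))
  (AllPairsP.map⁺ (AllPairs.map (λ v≉w v≗w → v≉w (ℤP.+-injective ∘ ℤP.neg-injective ∘ v≗w))
                                (weakCompositions-unique m (suc k))))
  (AllP.map⁺ (All.map (λ ∣v∣≡k → AllP.map⁺ (All.tabulate λ _ v≗-w →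
                         norm≡suc⇒≉0 ∣v∣≡k (nonneg≗nonpos⇒≗0 v≗-w)))
                      (weakCompositions-norm m (suc k))))
  where
  norm≡suc⇒≉0 : ∀ {u} → norm u ≡ suc k → u ≉ (λ _ → + 0)
  norm≡suc⇒≉0 ∣u∣≡k u≗0 with trans (sym ∣u∣≡k) (trans (norm-cong u≗0) (norm-0 m))
  ... | ()
  nonneg≗nonpos⇒≗0 : ∀ {v w : Fin m → ℕ} →
                     (λ i → + v i) ≗ (λ i → ℤ.- (+ w i)) → (λ i → + v i) ≗ (λ _ → + 0)
  nonneg≗nonpos⇒≗0 {v} {w} v≗-w i with v i | w i | v≗-w i
  ... | zero  | _ | _ = refl
  ... | suc _ | zero  | ()
  ... | suc _ | suc _ | ()
  zero≉ : All ((λ _ → + 0) ≉_) (map (λ v i → + v i) (weakCompositions m (suc k)) ++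
                                map (λ v i → ℤ.- (+ v i)) (weakCompositions m (suc k)))
  zero≉ = AllP.++⁺
    (AllP.map⁺ (All.map (λ ∣v∣≡k 0≗v → norm≡suc⇒≉0 ∣v∣≡k (sym ∘ 0≗v))
                        (weakCompositions-norm m (suc k))))
    (AllP.map⁺ (All.map (λ {v} ∣v∣≡k 0≗-v → norm≡suc⇒≉0 (trans (norm-neg (+_ ∘ v)) ∣v∣≡k) (sym ∘ 0≗-v))
                        (weakCompositions-norm m (suc k))))

proposition2 : ∀ {c ℓ} (G : AbelianGroup c ℓ) (n : ℕ) → HasOrder G n → 2 ≤ n →
               (t : ℕ) → 2 ≤ t →
               ∀ (m : ℕ) (a : Fin m → AbelianGroup.Carrier G) →
               Distinct G a → TIndependent G t a →
               2 * m ^ ⌊ t /2⌋ < (⌊ t /2⌋ !) * n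
proposition2 _ _ _ _ (suc zero) (s≤s ()) _ _ _ _
proposition2 G n G≅Fin _ t@(suc (suc _)) _ m a _ independent = begin-strict
  2 * m ^ k          ≤⟨ ℕP.*-monoʳ-≤ 2 (^≤!*length-weakCompositions m k) ⟩
  2 * (k ! * L)      ≡⟨ double (k !) L ⟩
  k ! * (L + L)      <⟨ ℕP.*-monoʳ-< (k !) (ℕP.n<1+n (L + L)) ⟩
  k ! * suc (L + L)  ≡⟨ cong (k ! *_) (length-signedWeakCompositions m k) ⟨
  k ! * length (signedWeakCompositions m k)
    ≤⟨ ℕP.*-monoʳ-≤ (k !) (independent⇒length≤order G G≅Fin independent (⌊n/2⌋+⌊n/2⌋≤n t)
                            (signedWeakCompositions-norm m k) (signedWeakCompositions-unique m _)) ⟩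
  k ! * n            ∎
  where
  open ℕP.≤-Reasoning
  k L : ℕ
  k = ⌊ t /2⌋
  L = length (weakCompositions m k)
  instance
    k!≢0 : ℕ.NonZero (k !)
    k!≢0 = ℕP._!≢0 k
  double : ∀ x y → 2 * (x * y) ≡ x * (y + y)
  double = solve-∀
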